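{- Let $(t_k)_{k\ge0}$ be the Thue–Morse sequence on $\{ -1,1\}$, defined by $t_0=1$, $t_{2k}=t_k$ and $t_{2k+1}=-t_k$ for $k\ge0$. Let $J=\{(2n+1)2^{2j}-1 \mid n,j\ge 0 \text{ integers}\}$. For every integer $k\ge0$, the integer $\delta_k:=(t_{k+1}-t_k)/2$ is odd if and only if $k\in J$. -}

module Defs where

open import Data.Nat as ℕ using (ℕ; zero; suc; _*_; _+_; _^_; _∸_)
open import Data.Nat.Base using (_/_; _%_)
open import Data.Integer as ℤ using (ℤ; +_; -_)
import Data.Integer.DivMod as ℤD

-- Thue–Morse on {-1,1}: t 0 = 1, t (2k) = t k, t (2k+1) = - t k.
-- Implemented with a fuel argument (fuel k+1 always suffices, since each
-- step halves k) to satisfy the termination checker.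
tm-fuel : ℕ → ℕ → ℤ
tm-fuel zero    k       = + 1
tm-fuel (suc f) zero    = + 1
tm-fuel (suc f) (suc k) with (suc k) % 2
... | zero  = tm-fuel f (suc k / 2)
... | suc _ = - tm-fuel f (suc k / 2)

t : ℕ → ℤ
t k = tm-fuel (suc k) k

δ : ℕ → ℤ
δ k = (t (suc k) ℤ.- t k) ℤD./ (+ 2)

J : ℕ → Set
J k = Σ ℕ λ n → Σ ℕ λ j → k ≡ (2 * n + 1) * 2 ^ (2 * j) ∸ 1
  where open import Data.Product using (Σ)
        open import Relation.Binary.PropositionalEquality using (_≡_)

-- Write K n v = (2n+1)2^v − 1; every k has this form, with v the number of
-- trailing ones of k in binary. Since t takes values ±1, δ k is even iff
-- t (k+1) = t k. From t (2m) = t m and t (2m+1) = − t m one gets that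
-- t (2m+1) ≠ t (2m) always, and that t (2m+2) = t (2m+1) iff t (m+1) ≠ t m.
-- As K n (v+1) = 2 K n v + 1 and K n 0 = 2n, an induction on v shows that
-- t (K n v + 1) = t (K n v) holds exactly when v is odd.
module Submission where

open import Defs
open import Data.Nat using (ℕ)
open import Data.Integer using (+_)
open import Data.Integer.Divisibility using (_∣_)
open import Relation.Nullary using (¬_)
open import Data.Product using (_×_)

open import Data.Nat using (zero; suc; _*_; _+_; _^_; _∸_; _≤_; _<_; s≤s; z≤n)
open import Data.Nat.Base using (_/_; _%_)
open import Data.Nat.Properties as ℕP using ()
open import Data.Nat.DivMod using (m*n%n≡0; m*n/n≡m; [m+kn]%n≡m%n; +-distrib-/-∣ʳ; m/n<m)
open import Data.Nat.Divisibility as ℕD using (n∣m*n; ∣1⇒≡1)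
open import Data.Nat.Induction using (<-rec)
open import Data.Integer as ℤ using (ℤ; -_)
open import Data.Product using (Σ; _,_)
open import Data.Sum using (_⊎_; inj₁; inj₂)
open import Data.Empty using (⊥-elim)
open import Function using (_∘_)
open import Relation.Binary.PropositionalEquality
  using (_≡_; _≢_; refl; sym; trans; cong; cong₂; subst; module ≡-Reasoning)

sign : ℕ → ℤ → ℤ
sign zero    x = x
sign (suc _) x = - x

tm-fuel-step : ∀ f k → tm-fuel (suc f) (suc k) ≡ sign (suc k % 2) (tm-fuel f (suc k / 2))
tm-fuel-step f k with suc k % 2
... | zero  = refl
... | suc _ = refl

[1+k]/2<1+k : ∀ k → suc k / 2 < suc k
[1+k]/2<1+k k = m/n<m (suc k) 2 (s≤s (s≤s z≤n))

tm-fuel-irrelevant : ∀ {f g} k → k < f → k < g → tm-fuel f k ≡ tm-fuel g k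
tm-fuel-irrelevant {suc f} {suc g} zero    _         _         = refl
tm-fuel-irrelevant {suc f} {suc g} (suc k) (s≤s k<f) (s≤s k<g) = begin
  tm-fuel (suc f) (suc k)                  ≡⟨ tm-fuel-step f k ⟩
  sign (suc k % 2) (tm-fuel f (suc k / 2)) ≡⟨ cong (sign (suc k % 2)) (tm-fuel-irrelevant (suc k / 2) (half<f k<f) (half<f k<g)) ⟩
  sign (suc k % 2) (tm-fuel g (suc k / 2)) ≡⟨ tm-fuel-step g k ⟨
  tm-fuel (suc g) (suc k)                  ∎
  where
  open ≡-Reasoning
  half<f : ∀ {h} → suc k ≤ h → suc k / 2 < h
  half<f = ℕP.<-≤-trans ([1+k]/2<1+k k)

t-step : ∀ k → t k ≡ sign (k % 2) (t (k / 2))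
t-step zero    = refl
t-step (suc k) = trans (tm-fuel-step (suc k) k)
  (cong (sign (suc k % 2)) (tm-fuel-irrelevant (suc k / 2) ([1+k]/2<1+k k) (ℕP.n<1+n (suc k / 2))))

t-double : ∀ m → t (m * 2) ≡ t m
t-double m = trans (t-step (m * 2)) (cong₂ sign (m*n%n≡0 m 2) (cong t (m*n/n≡m m 2)))

t-double+1 : ∀ m → t (1 + m * 2) ≡ - t m
t-double+1 m = trans (t-step (1 + m * 2)) (cong₂ sign ([m+kn]%n≡m%n 1 m 2) (cong t [1+m*2]/2≡m))
  where
  [1+m*2]/2≡m : (1 + m * 2) / 2 ≡ m
  [1+m*2]/2≡m = trans (+-distrib-/-∣ʳ 1 (n∣m*n m {2})) (m*n/n≡m m 2)

IsUnit : ℤ → Set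
IsUnit x = x ≡ + 1 ⊎ x ≡ - + 1

sign-unit : ∀ b {x} → IsUnit x → IsUnit (sign b x)
sign-unit zero    u              = u
sign-unit (suc _) (inj₁ refl) = inj₂ refl
sign-unit (suc _) (inj₂ refl) = inj₁ refl

tm-fuel-unit : ∀ f k → IsUnit (tm-fuel f k)
tm-fuel-unit zero    k       = inj₁ refl
tm-fuel-unit (suc f) zero    = inj₁ refl
tm-fuel-unit (suc f) (suc k) = subst IsUnit (sym (tm-fuel-step f k))
  (sign-unit (suc k % 2) (tm-fuel-unit f (suc k / 2)))

t-unit : ∀ k → IsUnit (t k)
t-unit k = tm-fuel-unit (suc k) k

unit-neg-≢ : ∀ {x} → IsUnit x → - x ≢ x
unit-neg-≢ (inj₁ refl) ()
unit-neg-≢ (inj₂ refl) ()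

unit-≡⊎≡neg : ∀ {x y} → IsUnit x → IsUnit y → y ≡ x ⊎ y ≡ - x
unit-≡⊎≡neg (inj₁ refl) (inj₁ refl) = inj₁ refl
unit-≡⊎≡neg (inj₁ refl) (inj₂ refl) = inj₂ refl
unit-≡⊎≡neg (inj₂ refl) (inj₁ refl) = inj₂ refl
unit-≡⊎≡neg (inj₂ refl) (inj₂ refl) = inj₁ refl

half-difference-≡ : ∀ {x} → IsUnit x → + 2 ∣ (x ℤ.- x) ℤ./ + 2
half-difference-≡ (inj₁ refl) = 2 ℕD.∣0
half-difference-≡ (inj₂ refl) = 2 ℕD.∣0

half-difference-neg : ∀ {x} → IsUnit x → ¬ (+ 2 ∣ (- x ℤ.- x) ℤ./ + 2)
half-difference-neg (inj₁ refl) 2∣1 with () ← ∣1⇒≡1 2∣1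
half-difference-neg (inj₂ refl) 2∣1 with () ← ∣1⇒≡1 2∣1

Same : ℕ → Set
Same k = t (suc k) ≡ t k

same⇒δ-even : ∀ k → Same k → + 2 ∣ δ k
same⇒δ-even k same rewrite same = half-difference-≡ (t-unit k)

¬same⇒δ-odd : ∀ k → ¬ Same k → ¬ (+ 2 ∣ δ k)
¬same⇒δ-odd k ¬same with unit-≡⊎≡neg (t-unit k) (t-unit (suc k))
... | inj₁ same = ⊥-elim (¬same same)
... | inj₂ neg rewrite neg = half-difference-neg (t-unit k)

¬same-double : ∀ m → ¬ Same (m * 2)
¬same-double m same = unit-neg-≢ (t-unit m) (begin
  - t m          ≡⟨ t-double+1 m ⟨
  t (1 + m * 2)  ≡⟨ same ⟩
  t (m * 2)      ≡⟨ t-double m ⟩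
  t m            ∎)
  where open ≡-Reasoning

-- Same (1 + m * 2) says t (suc m) ≡ - t m, because suc (1 + m * 2) is suc m * 2.
¬same⇒same-double+1 : ∀ m → ¬ Same m → Same (1 + m * 2)
¬same⇒same-double+1 m ¬same with unit-≡⊎≡neg (t-unit m) (t-unit (suc m))
... | inj₁ same = ⊥-elim (¬same same)
... | inj₂ neg  = trans (t-double (suc m)) (trans neg (sym (t-double+1 m)))

same⇒¬same-double+1 : ∀ m → Same m → ¬ Same (1 + m * 2)
same⇒¬same-double+1 m same same′ = unit-neg-≢ (t-unit m) (begin
  - t m              ≡⟨ t-double+1 m ⟨
  t (1 + m * 2)      ≡⟨ same′ ⟨
  t (suc m * 2)      ≡⟨ t-double (suc m) ⟩
  t (suc m)          ≡⟨ same ⟩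
  t m                ∎)
  where open ≡-Reasoning

K : ℕ → ℕ → ℕ
K n v = (2 * n + 1) * 2 ^ v ∸ 1

K-zero : ∀ n → K n 0 ≡ n * 2
K-zero n = begin
  (2 * n + 1) * 1 ∸ 1  ≡⟨ cong (_∸ 1) (ℕP.*-identityʳ (2 * n + 1)) ⟩
  2 * n + 1 ∸ 1        ≡⟨ ℕP.m+n∸n≡m (2 * n) 1 ⟩
  2 * n                ≡⟨ ℕP.*-comm 2 n ⟩
  n * 2                ∎
  where open ≡-Reasoning

*2∸1 : ∀ {a} → 1 ≤ a → a * 2 ∸ 1 ≡ 1 + (a ∸ 1) * 2
*2∸1 {suc a} _ = refl

K-suc : ∀ n v → K n (suc v) ≡ 1 + K n v * 2
K-suc n v = begin
  (2 * n + 1) * (2 * 2 ^ v) ∸ 1  ≡⟨ cong (λ a → (2 * n + 1) * a ∸ 1) (ℕP.*-comm 2 (2 ^ v)) ⟩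
  (2 * n + 1) * (2 ^ v * 2) ∸ 1  ≡⟨ cong (_∸ 1) (ℕP.*-assoc (2 * n + 1) (2 ^ v) 2) ⟨
  (2 * n + 1) * 2 ^ v * 2 ∸ 1    ≡⟨ *2∸1 (ℕP.*-mono-≤ (ℕP.m≤n+m 1 (2 * n)) (ℕP.m^n>0 2 v)) ⟩
  1 + K n v * 2                  ∎
  where open ≡-Reasoning

mutual
  ¬same-K-even : ∀ n j → ¬ Same (K n (2 * j))
  ¬same-K-even n zero    = subst (¬_ ∘ Same) (sym (K-zero n)) (¬same-double n)
  ¬same-K-even n (suc j) = subst (¬_ ∘ Same) (sym K-eq)
    (same⇒¬same-double+1 (K n (suc (2 * j))) (same-K-odd n j))
    where
    K-eq : K n (2 * suc j) ≡ 1 + K n (suc (2 * j)) * 2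
    K-eq = trans (cong (K n) (ℕP.*-suc 2 j)) (K-suc n (suc (2 * j)))

  same-K-odd : ∀ n j → Same (K n (suc (2 * j)))
  same-K-odd n j = subst Same (sym (K-suc n (2 * j)))
    (¬same⇒same-double+1 (K n (2 * j)) (¬same-K-even n j))

parity : ∀ k → Σ ℕ λ m → k ≡ m * 2 ⊎ k ≡ 1 + m * 2
parity zero    = 0 , inj₁ refl
parity (suc k) with parity k
... | m , inj₁ k≡2m   = m , inj₂ (cong suc k≡2m)
... | m , inj₂ k≡2m+1 = suc m , inj₁ (cong suc k≡2m+1)

K-surjective : ∀ k → Σ ℕ λ n → Σ ℕ λ v → k ≡ K n v
K-surjective = <-rec _ decompose
  where
  decompose : ∀ k → (∀ {m} → m < k → Σ ℕ λ n → Σ ℕ λ v → m ≡ K n v) → Σ ℕ λ n → Σ ℕ λ v → k ≡ K n v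
  decompose k rec with parity k
  ... | m , inj₁ k≡2m   = m , 0 , trans k≡2m (sym (K-zero m))
  ... | m , inj₂ k≡2m+1 with rec (subst (m <_) (sym k≡2m+1) (s≤s (ℕP.m≤m*n m 2)))
  ... | n , v , m≡K = n , suc v , trans k≡2m+1 (trans (cong (λ x → 1 + x * 2) m≡K) (sym (K-suc n v)))

lemma2 : (k : ℕ) → ((¬ (+ 2 ∣ δ k)) → J k) × (J k → ¬ (+ 2 ∣ δ k))
lemma2 k = δ-odd⇒J , J⇒δ-odd
  where
  J⇒δ-odd : J k → ¬ (+ 2 ∣ δ k)
  J⇒δ-odd (n , j , k≡K) = ¬same⇒δ-odd k (subst (¬_ ∘ Same) (sym k≡K) (¬same-K-even n j))

  δ-odd⇒J : ¬ (+ 2 ∣ δ k) → J k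
  δ-odd⇒J δ-odd with K-surjective k
  ... | n , v , k≡K with parity v
  ... | j , inj₁ v≡2j   = n , j , trans k≡K (cong (K n) (trans v≡2j (ℕP.*-comm j 2)))
  ... | j , inj₂ v≡2j+1 = ⊥-elim (δ-odd (same⇒δ-even k (subst Same (sym k≡K′) (same-K-odd n j))))
    where
    k≡K′ : k ≡ K n (suc (2 * j))
    k≡K′ = trans k≡K (cong (K n) (trans v≡2j+1 (cong suc (ℕP.*-comm j 2))))
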